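{- Fix an automaton $i$, start time $t$, length $h$, and a canonical transition set $\mathcal C_{i,t,h}$. For any state $s\in A$, there are at most $|\mathcal C_{i,t,h}|$ states $s'$ of the form $s'=F^h(i,r,s,t)$ with $r\in\{0,1\}^h$.
   Context: Automata setting: automata $i\in[m]$ with state space $A$, driven by bits; $F^h(i,r,s,t)$ is the state reached by automaton $i$ from state $s$ at time $t$ after reading $r\in\{0,1\}^h$. For fixed $i,t,h$, write $(s_1,s_2)\sim(s_1',s_2')$ if for all $r\in\{0,1\}^h$: $F^h(i,r,s_1,t)=s_2\iff F^h(i,r,s_1',t)=s_2'$. A set $\mathcal C_{i,t,h}\subseteq A\times A$ is a canonical transition set if every $(s_1,s_2)\in A\times A$ is $\sim$-equivalent to some pair in $\mathcal C_{i,t,h}$. -}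

module Defs where

open import Data.Nat using (ℕ)
open import Data.Fin using (Fin)
open import Data.Bool using (Bool)
open import Data.Vec using (Vec)
open import Data.Product using (_×_; _,_; Σ; ∃; ∃-syntax)
open import Data.List using (List)
open import Data.List.Membership.Propositional using (_∈_)
open import Relation.Binary.PropositionalEquality using (_≡_)
open import Function.Bundles using (_⇔_)

-- A transition function for m automata with state space A:
-- Trans m A h i r s t  is  F^h(i, r, s, t), the state reached by automaton i
-- from state s at time t after reading the bit string r ∈ {0,1}^h.
Trans : ℕ → Set → Set
Trans m A = (h : ℕ) → Fin m → Vec Bool h → A → ℕ → A

Equiv : ∀ {m A} → Trans m A → Fin m → ℕ → ℕ → A × A → A × A → Set
Equiv F i t h (s₁ , s₂) (s₁' , s₂') =
  (r : Vec Bool h) → (F h i r s₁ t ≡ s₂) ⇔ (F h i r s₁' t ≡ s₂')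

IsCanonical : ∀ {m A} → Trans m A → Fin m → ℕ → ℕ → List (A × A) → Set
IsCanonical {A = A} F i t h C =
  (p : A × A) → ∃[ q ] (q ∈ C × Equiv F i t h p q)

Reachable : ∀ {m A} → Trans m A → Fin m → ℕ → ℕ → A → A → Set
Reachable F i t h s s' = ∃[ r ] (F h i r s t ≡ s')

-- Send each reachable state s' to the canonical representative of the pair (s, s').
-- This is injective on reachable states: if (s, s₁) and (s, s₂) are both equivalent
-- to the same canonical pair and a word r leads from s to s₁, the two equivalences
-- transport "r leads to s₁" to "r leads to s₂", so s₁ = s₂.  Distinct reachable
-- states therefore give distinct elements of C, and the bound is the pigeonhole principle.
module Submission where

open import Defs
open import Level using (Level)
open import Data.Nat using (ℕ; _≤_; suc; s≤s; z≤n)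
open import Data.Nat.Properties using (module ≤-Reasoning)
open import Data.Fin using (Fin)
open import Data.Product using (_×_; _,_; proj₁; proj₂)
open import Data.List using (List; length; map; []; _∷_; _++_)
open import Data.List.Properties using (length-++-sucʳ; length-map)
open import Data.List.Relation.Unary.All as All using (All; []; _∷_)
import Data.List.Relation.Unary.All.Properties as All
open import Data.List.Relation.Unary.Any using (here; there)
open import Data.List.Relation.Unary.Unique.Propositional using (Unique; []; _∷_)
open import Data.List.Membership.Propositional using (_∈_)
open import Data.List.Membership.Propositional.Properties using (∈-∃++; ∈-++⁻; ∈-++⁺ˡ; ∈-++⁺ʳ; ∈-map⁻)
open import Data.List.Relation.Binary.Subset.Propositional using (_⊆_)
open import Data.Sum using (inj₁; inj₂)
open import Function using (_∘_)
open import Function.Bundles using (Equivalence)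
open import Relation.Binary.PropositionalEquality using (_≡_; _≢_; refl; sym; trans; subst)
open import Relation.Nullary using (contradiction)
open import Relation.Unary using (Pred)

private
  variable
    a b ℓ : Level
    X Y : Set a

∈-++-∷-≢ : ∀ {x y : X} us {vs} → x ∈ us ++ y ∷ vs → x ≢ y → x ∈ us ++ vs
∈-++-∷-≢ us x∈ x≢y with ∈-++⁻ us x∈
... | inj₁ x∈us         = ∈-++⁺ˡ x∈us
... | inj₂ (here x≡y)   = contradiction x≡y x≢y
... | inj₂ (there x∈vs) = ∈-++⁺ʳ us x∈vs

Unique∧⊆⇒length≤ : {xs ys : List X} → Unique xs → xs ⊆ ys → length xs ≤ length ys
Unique∧⊆⇒length≤ {xs = []}     _             _        = z≤n
Unique∧⊆⇒length≤ {xs = x ∷ xs} (x≢xs ∷ xs!) x∷xs⊆ys with ∈-∃++ (x∷xs⊆ys (here refl))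
... | us , vs , refl = begin
  suc (length xs)         ≤⟨ s≤s (Unique∧⊆⇒length≤ xs! xs⊆us++vs) ⟩
  suc (length (us ++ vs)) ≡⟨ sym (length-++-sucʳ us x vs) ⟩
  length (us ++ x ∷ vs)   ∎
  where
  open ≤-Reasoning
  xs⊆us++vs : xs ⊆ us ++ vs
  xs⊆us++vs y∈xs = ∈-++-∷-≢ us (x∷xs⊆ys (there y∈xs)) (All.lookup x≢xs y∈xs ∘ sym)

map⁺-injectiveOn : {P : Pred X ℓ} {f : X → Y} →
                   (∀ {x y} → P x → P y → f x ≡ f y → x ≡ y) →
                   {xs : List X} → All P xs → Unique xs → Unique (map f xs)
map⁺-injectiveOn f-inj []         []           = []
map⁺-injectiveOn f-inj (px ∷ pxs) (x≢xs ∷ xs!) =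
  All.map⁺ (All.zipWith (λ (py , x≢y) → x≢y ∘ f-inj px py) (pxs , x≢xs))
  ∷ map⁺-injectiveOn f-inj pxs xs!

module _ {m : ℕ} {A : Set} (F : Trans m A) (i : Fin m) (t h : ℕ) where

  reachable-determined-by-class : ∀ {s s₁ s₂ q} →
    Equiv F i t h (s , s₁) q → Equiv F i t h (s , s₂) q →
    Reachable F i t h s s₁ → s₁ ≡ s₂
  reachable-determined-by-class {q = _ , _} s₁∼q s₂∼q (r , Fr≡s₁) =
    trans (sym Fr≡s₁) (Equivalence.from (s₂∼q r) (Equivalence.to (s₁∼q r) Fr≡s₁))

  module Representative {C : List (A × A)} (canonical : IsCanonical F i t h C) (s : A) where

    rep : A → A × A
    rep s' = proj₁ (canonical (s , s'))

    rep-class : ∀ s' → Equiv F i t h (s , s') (rep s')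
    rep-class s' = proj₂ (proj₂ (canonical (s , s')))

    rep-injectiveOn-reachable : ∀ {s₁ s₂} → Reachable F i t h s s₁ → Reachable F i t h s s₂ →
                                rep s₁ ≡ rep s₂ → s₁ ≡ s₂
    rep-injectiveOn-reachable {s₁} {s₂} reach _ rep≡ =
      reachable-determined-by-class (rep-class s₁)
                                    (subst (Equiv F i t h (s , s₂)) (sym rep≡) (rep-class s₂)) reach

    map-rep⊆C : (S : List A) → map rep S ⊆ C
    map-rep⊆C S p∈ with ∈-map⁻ rep p∈
    ... | s' , _ , refl = proj₁ (proj₂ (canonical (s , s')))

mainTheorem12 : {m : ℕ} {A : Set} (F : Trans m A) (i : Fin m) (t h : ℕ)
    (C : List (A × A)) → Unique C → IsCanonical F i t h C →
    (s : A) (S : List A) → Unique S → All (Reachable F i t h s) S →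
    length S ≤ length C
mainTheorem12 F i t h C _ canonical s S S! reach = begin
  length S           ≡⟨ sym (length-map rep S) ⟩
  length (map rep S) ≤⟨ Unique∧⊆⇒length≤ rep[S]! (map-rep⊆C S) ⟩
  length C           ∎
  where
  open ≤-Reasoning
  open Representative F i t h canonical s
  rep[S]! : Unique (map rep S)
  rep[S]! = map⁺-injectiveOn rep-injectiveOn-reachable reach S!
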